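{- Let $A$ be a graph of order $n$ and let $A_1,A_2,\dots$ be the sequence of the SaS process applied to $A$. Then: (1) each $A_i$ recognizes vertices; (2) $A_i\rightarrowtail A_{i+1}$ and $\dim(A_i)\le\dim(A_{i+1})$ for every integer $i>0$; (3) if $\dim(A_t)=\dim(A_{t+1})$ for some $t\in\mathbb{Z}^+$, then $A_t\approx\hat A$.
   Context: Labels are independent commuting indeterminates $x_0,x_1,\dots$; $\mathrm{Var}=\{x_1,x_2,\dots\}$. A graph of order $n$ is a symmetric $n\times n$ matrix over $\{x_0\}\cup\mathrm{Var}$; $\dim(G)$ is its number of distinct entries. Products and powers ($G^0=I$) are computed in the commutative polynomial ring over $\mathbb{R}$ in the indeterminates and an extra indeterminate $\lambda$. $A\rightarrowtail B$ means $b_{ij}=b_{st}\Rightarrow a_{ij}=a_{st}$ for all $i,j,s,t$; $A\approx B$ means both directions. An equivalent variable substitution replaces the entries of a matrix by variables of $\mathrm{Var}$, equal entries by equal variables and distinct by distinct. A graph recognizes vertices if no diagonal entry equals an off-diagonal entry. Description graph: $\tilde G$ is obtained from $\Gamma(G)=\sum_{k=0}^{n-1}\lambda^kG^k$ by an equivalent variable substitution. Stable graph $\hat A$: set $B_0=A$, $B_{k+1}=\tilde{B_k}$, and $\hat A:=B_t$ for the first $t$ with $\dim(B_t)=\dim(B_{t+1})$ (defined up to $\approx$). SaS process: $A_1$ is $A$ with its diagonal entries replaced by an equivalent variable substitution using fresh variables not occurring off the diagonal (off-diagonal entries unchanged); $A_{i+1}$ is obtained from $A_i^2$ by an equivalent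 variable substitution. -}

module Defs where

open import Data.Nat using (ℕ; zero; suc; _≤_; _<_; _∸_)
open import Data.Nat.Properties using (_≟_)
open import Data.Fin using (Fin; toℕ)
open import Data.List using (List; []; _∷_; _++_; map; concatMap; length; deduplicate; allFin; upTo; replicate)
open import Data.Product using (_×_; Σ; ∃; _,_)
open import Relation.Binary.PropositionalEquality using (_≡_; _≢_)
open import Relation.Binary.Bundles using (Setoid)
open import Function.Bundles using (_⇔_)
open import Relation.Nullary using (yes; no)
import Data.List.Relation.Binary.Permutation.Propositional as PermP
import Data.List.Relation.Binary.Permutation.Setoid as PermS

-- Indeterminates: λ and x_ℓ (ℓ : ℕ).  x_0 is the special label,
-- Var = { x_ℓ | ℓ ≥ 1 }.

data Ind : Set where
  lam : Ind
  var : ℕ → Ind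

-- A monomial is a multiset of indeterminates (a list, up to permutation);
-- a polynomial with natural-number coefficients is a multiset of
-- monomials (repetition = coefficient).  All polynomials arising here
-- (entries of products/powers of label matrices, weighted by powers of λ)
-- have coefficients in ℕ, and ℕ[X] embeds in ℝ[X], so equality in ℝ[X]
-- coincides with the equality _≈P_ below.

Mono : Set
Mono = List Ind

Poly : Set
Poly = List Mono

monoSetoid : Setoid _ _
monoSetoid = PermP.↭-setoid {A = Ind}

_≈P_ : Poly → Poly → Set
p ≈P q = PermS._↭_ monoSetoid p q

0P : Poly
0P = []

1P : Poly
1P = [] ∷ []

_+P_ : Poly → Poly → Poly
p +P q = p ++ q

_*P_ : Poly → Poly → Poly
p *P q = concatMap (λ m → map (λ m' → m ++ m') q) p

ΣFin : (n : ℕ) → (Fin n → Poly) → Poly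
ΣFin n f = concatMap f (allFin n)

-- Graphs: matrices of labels (label ℓ stands for x_ℓ).

Graph : ℕ → Set
Graph n = Fin n → Fin n → ℕ

PMat : ℕ → Set
PMat n = Fin n → Fin n → Poly

Symmetric : ∀ {n} → Graph n → Set
Symmetric {n} G = ∀ (i j : Fin n) → G i j ≡ G j i

toP : ∀ {n} → Graph n → PMat n
toP G i j = (var (G i j) ∷ []) ∷ []

idP : ∀ {n} → PMat n
idP i j with toℕ i ≟ toℕ j
... | yes _ = 1P
... | no _ = 0P

_·_ : ∀ {n} → PMat n → PMat n → PMat n
_·_ {n} M N i j = ΣFin n (λ l → M i l *P N l j)

_^P_ : ∀ {n} → PMat n → ℕ → PMat n
M ^P zero = idP
M ^P suc k = M · (M ^P k)

lamPow : ℕ → Poly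
lamPow k = replicate k lam ∷ []

Γ : ∀ {n} → Graph n → PMat n
Γ {n} G i j = concatMap (λ k → lamPow k *P ((toP G ^P k) i j)) (upTo n)

entries : ∀ {n} → Graph n → List ℕ
entries {n} G = concatMap (λ i → map (λ j → G i j) (allFin n)) (allFin n)

dim : ∀ {n} → Graph n → ℕ
dim G = length (deduplicate _≟_ (entries G))

_↣_ : ∀ {n} → Graph n → Graph n → Set
_↣_ {n} A B = ∀ (i j s t : Fin n) → B i j ≡ B s t → A i j ≡ A s t

_≈G_ : ∀ {n} → Graph n → Graph n → Set
A ≈G B = (A ↣ B) × (B ↣ A)

EVS : ∀ {n} → PMat n → Graph n → Set
EVS {n} M G =
  (∀ (i j : Fin n) → 1 ≤ G i j) ×
  (∀ (i j s t : Fin n) → (G i j ≡ G s t) ⇔ (M i j ≈P M s t))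

RecognizesVertices : ∀ {n} → Graph n → Set
RecognizesVertices {n} G = ∀ (i s t : Fin n) → s ≢ t → G i i ≢ G s t

-- SaS process.  S k stands for A_{k+1}  (so S 0 = A_1).

FirstStep : ∀ {n} → Graph n → Graph n → Set
FirstStep {n} A A₁ =
  (∀ (i j : Fin n) → i ≢ j → A₁ i j ≡ A i j) ×
  (∀ (i : Fin n) → 1 ≤ A₁ i i) ×
  (∀ (i s t : Fin n) → s ≢ t → A₁ i i ≢ A s t) ×
  (∀ (i j : Fin n) → (A₁ i i ≡ A₁ j j) ⇔ (A i i ≡ A j j))

IsSaS : ∀ {n} → Graph n → (ℕ → Graph n) → Set
IsSaS A S = FirstStep A (S 0) × (∀ k → EVS (toP (S k) · toP (S k)) (S (suc k)))

-- Description sequence B₀ = A, B_{k+1} = B̃_k, and its first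
-- stabilisation index (Â := B_t).

IsDescSeq : ∀ {n} → Graph n → (ℕ → Graph n) → Set
IsDescSeq {n} A B =
  (∀ (i j : Fin n) → B 0 i j ≡ A i j) × (∀ k → EVS (Γ (B k)) (B (suc k)))

FirstStable : ∀ {n} → (ℕ → Graph n) → ℕ → Set
FirstStable B t = (dim (B t) ≡ dim (B (suc t))) × (∀ k → k < t → dim (B k) ≢ dim (B (suc k)))

-- Squaring a vertex-recognizing graph cannot merge labels, and a description records I, G and G²
-- as its coefficients of λ⁰, λ¹, λ².  So both sequences refine, dim is monotone along them, and
-- once it stops growing the refinement is an equivalence and the graph T reached is square-closed:
-- equal labels of T give equal entries of T².  For such a T, also recognizing vertices, the
-- matrices whose entries are functions of the labels of T are closed under M, N ↦ MN + NM, because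
-- each entry of MN + NM is a symmetric function of the pairs (Tᵢₗ, Tₗⱼ), which (T²)ᵢⱼ determines.
-- Hence every power of a graph coarser than T, and with it its square and its description, is
-- again coarser than T.  Taking T = A_t for the description sequence and T = B_t′ for the SaS
-- sequence gives the two refinements between A_t and B_t′.

module Submission where

open import Defs
open import Data.Bool using (true; false; if_then_else_)
open import Data.Empty using (⊥-elim)
open import Data.Fin as Fin using (Fin; toℕ)
import Data.Fin.Properties as Finₚ
open import Data.Fin.Patterns using (0F; 1F)
open import Data.List
  using (List; []; _∷_; _++_; map; concat; concatMap; filter; length; replicate; allFin; upTo; deduplicate)
import Data.List.Properties as Listₚ
open import Data.List.Relation.Unary.All as All using (All; []; _∷_)
import Data.List.Relation.Unary.All.Properties as Allₚ
open import Data.List.Relation.Unary.Any as Any using (here; there)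
open import Data.List.Relation.Unary.Unique.Propositional using (Unique)
open import Data.List.Relation.Unary.AllPairs using ([]; _∷_)
import Data.List.Relation.Unary.Unique.Propositional.Properties as Uniqueₚ
import Data.List.Relation.Unary.Unique.DecPropositional.Properties as DecUniqueₚ
open import Data.List.Membership.Propositional using (_∈_; lose)
open import Data.List.Relation.Binary.Subset.Propositional using (_⊆_)
import Data.List.Membership.Propositional.Properties as ∈ₚ
open import Data.List.Relation.Binary.Permutation.Propositional as ↭ using (_↭_)
import Data.List.Relation.Binary.Permutation.Propositional.Properties as ↭ₚ
import Data.List.Relation.Binary.Permutation.Setoid as SetoidPerm
import Data.List.Relation.Binary.Permutation.Setoid.Properties as SetoidPermₚ
open import Data.Nat as ℕ using (ℕ; zero; suc; _≤_; _<_; z≤n; s≤s; _*_; _+_)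
import Data.Nat.Properties as ℕₚ
open import Data.Product using (_×_; ∃; _,_; proj₁; proj₂)
open import Data.Sum using (_⊎_; inj₁; inj₂; swap)
open import Function using (_∘_; Equivalence)
open import Relation.Binary.Bundles using (Setoid)
open import Relation.Binary.PropositionalEquality
  using (_≡_; _≢_; refl; sym; trans; cong; cong₂; subst; module ≡-Reasoning)
open import Relation.Nullary using (¬_; ¬?; Dec; yes; no; does; _×-dec_; _⊎-dec_)
open import Relation.Nullary.Decidable using (dec-true; dec-false)

-- Polynomial arithmetic up to ≈P

module ≈P = SetoidPerm monoSetoid
module ≈Pₚ = SetoidPermₚ monoSetoid

open ≈P using () renaming (↭-refl to ≈P-refl; ↭-sym to ≈P-sym; ↭-trans to ≈P-trans;
  ↭-reflexive to ≈P-reflexive)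

polySetoid : Setoid _ _
polySetoid = ≈P.↭-setoid

concatMap-cong-≈P : ∀ {A : Set} {f g : A → Poly} (xs : List A) →
                    (∀ x → f x ≈P g x) → concatMap f xs ≈P concatMap g xs
concatMap-cong-≈P []       f≈g = ≈P-refl
concatMap-cong-≈P (x ∷ xs) f≈g = ≈Pₚ.++⁺ (f≈g x) (concatMap-cong-≈P xs f≈g)

concatMap-resp-≈P : (f : Mono → Poly) → (∀ {m m′} → m ↭ m′ → f m ≈P f m′) →
                    ∀ {p q} → p ≈P q → concatMap f p ≈P concatMap f q
concatMap-resp-≈P f f-resp p≈q =
  SetoidPermₚ.foldr-commMonoid polySetoid ≈Pₚ.++-isCommutativeMonoid
    (≈Pₚ.map⁺ polySetoid f-resp p≈q)

concatMap-++-distrib : ∀ {A : Set} (f g : A → Poly) (xs : List A) →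
                       concatMap (λ x → f x ++ g x) xs ≈P (concatMap f xs ++ concatMap g xs)
concatMap-++-distrib f g []       = ≈P-refl
concatMap-++-distrib f g (x ∷ xs) = begin
  (f x ++ g x) ++ concatMap (λ x → f x ++ g x) xs  ↭⟨ ≈Pₚ.++-assoc (f x) (g x) _ ⟩
  f x ++ g x ++ concatMap (λ x → f x ++ g x) xs    ↭⟨ ≈Pₚ.++⁺ˡ (f x) (≈Pₚ.++⁺ˡ (g x) (concatMap-++-distrib f g xs)) ⟩
  f x ++ g x ++ concatMap f xs ++ concatMap g xs   ↭⟨ ≈Pₚ.++⁺ˡ (f x) (≈Pₚ.shifts (g x) (concatMap f xs)) ⟩
  f x ++ concatMap f xs ++ g x ++ concatMap g xs   ↭⟨ ≈Pₚ.++-assoc (f x) (concatMap f xs) _ ⟨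
  (f x ++ concatMap f xs) ++ g x ++ concatMap g xs ∎
  where open ≈P.PermutationReasoning

concatMap-concatMap : ∀ {A B C : Set} (f : B → List C) (g : A → List B) (xs : List A) →
                      concatMap f (concatMap g xs) ≡ concatMap (concatMap f ∘ g) xs
concatMap-concatMap f g []       = refl
concatMap-concatMap f g (x ∷ xs) =
  trans (Listₚ.concatMap-++ f (g x) _) (cong (concatMap f (g x) ++_) (concatMap-concatMap f g xs))

concatMap-vanish : ∀ {A : Set} {f : A → Poly} {xs : List A} →
                   All (λ x → f x ≈P []) xs → concatMap f xs ≈P []
concatMap-vanish []            = ≈P-refl
concatMap-vanish (fx≈[] ∷ all) = ≈Pₚ.++⁺ fx≈[] (concatMap-vanish all)

concatMap-comm : ∀ {A B : Set} (f : A → B → Poly) (xs : List A) (ys : List B) →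
                 concatMap (λ a → concatMap (f a) ys) xs ≈P concatMap (λ b → concatMap (λ a → f a b) xs) ys
concatMap-comm f []       ys = ≈P-sym (concatMap-vanish (All.universal (λ _ → ≈P-refl) ys))
concatMap-comm f (x ∷ xs) ys = ≈P-trans
  (≈Pₚ.++⁺ˡ (concatMap (f x) ys) (concatMap-comm f xs ys))
  (≈P-sym (concatMap-++-distrib (f x) (λ b → concatMap (λ a → f a b) xs) ys))

concatMap-single : ∀ {A : Set} {f : A → Poly} {xs : List A} {x : A} → Unique xs → x ∈ xs →
                   (∀ y → y ≢ x → f y ≈P []) → concatMap f xs ≈P f x
concatMap-single {f = f} (x∉xs ∷ _) (here refl) vanish = ≈P-trans
  (≈Pₚ.++⁺ˡ (f _) (concatMap-vanish (All.map (λ x≢y → vanish _ (x≢y ∘ sym)) x∉xs)))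
  (≈Pₚ.++-identityʳ (f _))
concatMap-single {f = f} (y∉xs ∷ unique) (there x∈xs) vanish =
  ≈P-trans (≈Pₚ.++⁺ʳ _ (vanish _ (All.lookup y∉xs x∈xs))) (concatMap-single unique x∈xs vanish)

map-as-concatMap : ∀ {A B : Set} (g : A → B) (xs : List A) → map g xs ≡ concatMap (λ x → g x ∷ []) xs
map-as-concatMap g xs = trans (sym (Listₚ.concatMap-pure (map g xs))) (Listₚ.concatMap-map (_∷ []) g xs)

*P-congˡ : ∀ {p p′} q → p ≈P p′ → (p *P q) ≈P (p′ *P q)
*P-congˡ q = concatMap-resp-≈P (λ m → map (m ++_) q) (λ m↭m′ → map-resp q (λ x → ↭ₚ.++⁺ʳ x m↭m′))
  where
  map-resp : ∀ q {g h : Mono → Mono} → (∀ m → g m ↭ h m) → map g q ≈P map h q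
  map-resp []      g↭h = ≈P-refl
  map-resp (m ∷ q) g↭h = ≈P.prep (g↭h m) (map-resp q g↭h)

*P-congʳ : ∀ p {q q′} → q ≈P q′ → (p *P q) ≈P (p *P q′)
*P-congʳ p q≈q′ = concatMap-cong-≈P p (λ m → ≈Pₚ.map⁺ monoSetoid (↭ₚ.++⁺ˡ m) q≈q′)

*P-cong : ∀ {p p′ q q′} → p ≈P p′ → q ≈P q′ → (p *P q) ≈P (p′ *P q′)
*P-cong {p′ = p′} {q = q} p≈p′ q≈q′ = ≈P-trans (*P-congˡ q p≈p′) (*P-congʳ p′ q≈q′)

*P-distribʳ-concatMap : ∀ {A : Set} (f : A → Poly) (xs : List A) q →
                        (concatMap f xs *P q) ≡ concatMap (λ x → f x *P q) xs
*P-distribʳ-concatMap f xs q = concatMap-concatMap (λ m → map (m ++_) q) f xs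

*P-distribˡ-concatMap : ∀ {A : Set} p (f : A → Poly) (xs : List A) →
                        (p *P concatMap f xs) ≈P concatMap (λ x → p *P f x) xs
*P-distribˡ-concatMap p f xs = ≈P-trans
  (≈P-reflexive (Listₚ.concatMap-cong (λ m → Listₚ.map-concatMap (m ++_) f xs) p))
  (concatMap-comm (λ m x → map (m ++_) (f x)) p xs)

*P-assoc : ∀ p q r → ((p *P q) *P r) ≈P (p *P (q *P r))
*P-assoc p q r = ≈P-reflexive (begin
  (p *P q) *P r                                              ≡⟨ *P-distribʳ-concatMap (λ m → map (m ++_) q) p r ⟩
  concatMap (λ m → map (m ++_) q *P r) p                     ≡⟨ Listₚ.concatMap-cong shift p ⟩
  concatMap (λ m → map (m ++_) (q *P r)) p                   ∎)
  where
  open ≡-Reasoning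
  shift : ∀ m → (map (m ++_) q *P r) ≡ map (m ++_) (q *P r)
  shift m = begin
    map (m ++_) q *P r                                       ≡⟨ Listₚ.concatMap-map (λ m′ → map (m′ ++_) r) (m ++_) q ⟩
    concatMap (λ m′ → map ((m ++ m′) ++_) r) q               ≡⟨ Listₚ.concatMap-cong (λ m′ → reassoc m′) q ⟩
    concatMap (λ m′ → map (m ++_) (map (m′ ++_) r)) q        ≡⟨ Listₚ.map-concatMap (m ++_) (λ m′ → map (m′ ++_) r) q ⟨
    map (m ++_) (q *P r)                                     ∎
    where
    reassoc : ∀ m′ → map ((m ++ m′) ++_) r ≡ map (m ++_) (map (m′ ++_) r)
    reassoc m′ = trans (Listₚ.map-cong (Listₚ.++-assoc m m′) r) (Listₚ.map-∘ r)

*P-comm : ∀ p q → (p *P q) ≈P (q *P p)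
*P-comm p q = begin
  p *P q
    ≡⟨ Listₚ.concatMap-cong (λ m → map-as-concatMap (m ++_) q) p ⟩
  concatMap (λ m → concatMap (λ m′ → (m ++ m′) ∷ []) q) p
    ↭⟨ concatMap-comm (λ m m′ → (m ++ m′) ∷ []) p q ⟩
  concatMap (λ m′ → concatMap (λ m → (m ++ m′) ∷ []) p) q
    ↭⟨ concatMap-cong-≈P q (λ m′ → concatMap-cong-≈P p (λ m → ≈P.prep (↭ₚ.++-comm m m′) ≈P-refl)) ⟩
  concatMap (λ m′ → concatMap (λ m → (m′ ++ m) ∷ []) p) q
    ≡⟨ Listₚ.concatMap-cong (λ m′ → map-as-concatMap (m′ ++_) p) q ⟨
  q *P p ∎
  where open ≈P.PermutationReasoning

*P-identityˡ : ∀ q → (1P *P q) ≈P q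
*P-identityˡ q = ≈P-reflexive (trans (Listₚ.++-identityʳ _) (Listₚ.map-id q))

*P-identityʳ : ∀ p → (p *P 1P) ≈P p
*P-identityʳ p = ≈P-reflexive (trans (Listₚ.concatMap-cong (λ m → cong (_∷ []) (Listₚ.++-identityʳ m)) p)
                                     (Listₚ.concatMap-pure p))

*P-zeroʳ : ∀ p → (p *P []) ≡ []
*P-zeroʳ []      = refl
*P-zeroʳ (m ∷ p) = *P-zeroʳ p

-- Matrices over the polynomial ring

infix 4 _≈M_

_≈M_ : ∀ {n} → PMat n → PMat n → Set
_≈M_ {n} M N = ∀ (i j : Fin n) → M i j ≈P N i j

≈M-refl : ∀ {n} {M : PMat n} → M ≈M M
≈M-refl i j = ≈P-refl

≈M-sym : ∀ {n} {M N : PMat n} → M ≈M N → N ≈M M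
≈M-sym M≈N i j = ≈P-sym (M≈N i j)

≈M-trans : ∀ {n} {M N Q : PMat n} → M ≈M N → N ≈M Q → M ≈M Q
≈M-trans M≈N N≈Q i j = ≈P-trans (M≈N i j) (N≈Q i j)

ΣFin-cong : ∀ n {f g : Fin n → Poly} → (∀ l → f l ≈P g l) → ΣFin n f ≈P ΣFin n g
ΣFin-cong n = concatMap-cong-≈P (allFin n)

ΣFin-single : ∀ {n} {f : Fin n → Poly} (i : Fin n) → (∀ l → l ≢ i → f l ≈P []) → ΣFin n f ≈P f i
ΣFin-single {n} i = concatMap-single (Uniqueₚ.allFin⁺ n) (∈ₚ.∈-allFin i)

idP-diag : ∀ {n} (i : Fin n) → idP i i ≡ 1P
idP-diag i with toℕ i ℕ.≟ toℕ i
... | yes _   = refl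
... | no  i≢i = ⊥-elim (i≢i refl)

idP-offDiag : ∀ {n} {i j : Fin n} → i ≢ j → idP i j ≡ []
idP-offDiag {i = i} {j} i≢j with toℕ i ℕ.≟ toℕ j
... | yes i≡j = ⊥-elim (i≢j (Finₚ.toℕ-injective i≡j))
... | no  _   = refl

·-cong : ∀ {n} {M M′ N N′ : PMat n} → M ≈M M′ → N ≈M N′ → M · N ≈M M′ · N′
·-cong {n} M≈M′ N≈N′ i j = ΣFin-cong n (λ l → *P-cong (M≈M′ i l) (N≈N′ l j))

·-assoc : ∀ {n} (M N Q : PMat n) → (M · N) · Q ≈M M · (N · Q)
·-assoc {n} M N Q i j = begin
  ΣFin n (λ l → (M · N) i l *P Q l j)
    ≡⟨ Listₚ.concatMap-cong (λ l → *P-distribʳ-concatMap (λ m → M i m *P N m l) (allFin n) (Q l j)) (allFin n) ⟩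
  ΣFin n (λ l → ΣFin n (λ m → (M i m *P N m l) *P Q l j))
    ↭⟨ ΣFin-cong n (λ l → ΣFin-cong n (λ m → *P-assoc (M i m) (N m l) (Q l j))) ⟩
  ΣFin n (λ l → ΣFin n (λ m → M i m *P (N m l *P Q l j)))
    ↭⟨ concatMap-comm (λ l m → M i m *P (N m l *P Q l j)) (allFin n) (allFin n) ⟩
  ΣFin n (λ m → ΣFin n (λ l → M i m *P (N m l *P Q l j)))
    ↭⟨ ΣFin-cong n (λ m → *P-distribˡ-concatMap (M i m) (λ l → N m l *P Q l j) (allFin n)) ⟨
  ΣFin n (λ m → M i m *P (N · Q) m j) ∎
  where open ≈P.PermutationReasoning

·-identityˡ : ∀ {n} (M : PMat n) → idP · M ≈M M
·-identityˡ M i j = begin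
  ΣFin _ (λ l → idP i l *P M l j)
    ↭⟨ ΣFin-single i (λ l l≢i → ≈P-reflexive (cong (_*P M l j) (idP-offDiag (l≢i ∘ sym)))) ⟩
  idP i i *P M i j
    ≡⟨ cong (_*P M i j) (idP-diag i) ⟩
  1P *P M i j
    ↭⟨ *P-identityˡ (M i j) ⟩
  M i j ∎
  where open ≈P.PermutationReasoning

·-identityʳ : ∀ {n} (M : PMat n) → M · idP ≈M M
·-identityʳ M i j = begin
  ΣFin _ (λ l → M i l *P idP l j)
    ↭⟨ ΣFin-single j (λ l l≢j → ≈P-reflexive (trans (cong (M i l *P_) (idP-offDiag l≢j)) (*P-zeroʳ (M i l)))) ⟩
  M i j *P idP j j
    ≡⟨ cong (M i j *P_) (idP-diag j) ⟩
  M i j *P 1P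
    ↭⟨ *P-identityʳ (M i j) ⟩
  M i j ∎
  where open ≈P.PermutationReasoning

^P-suc-comm : ∀ {n} (M : PMat n) k → (M ^P k) · M ≈M M ^P suc k
^P-suc-comm M zero    = ≈M-trans (·-identityˡ M) (≈M-sym (·-identityʳ M))
^P-suc-comm M (suc k) = ≈M-trans (·-assoc M (M ^P k) M) (·-cong (≈M-refl {M = M}) (^P-suc-comm M k))

-- Entries of a square

↭-pair-inv : ∀ {A : Set} {m : List A} {x y : A} → m ↭ x ∷ y ∷ [] → m ≡ x ∷ y ∷ [] ⊎ m ≡ y ∷ x ∷ []
↭-pair-inv {m = m} m↭xy with ↭ₚ.↭-length m↭xy
↭-pair-inv {m = u ∷ v ∷ []} m↭xy | refl with ↭ₚ.∈-resp-↭ m↭xy (here refl)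
... | here refl with refl ← ↭ₚ.↭-singleton-inv (↭ₚ.drop-∷ m↭xy) = inj₁ refl
↭-pair-inv {m = u ∷ v ∷ []} {x} {y} m↭xy | refl | there (here refl)
  with refl ← ↭ₚ.↭-singleton-inv (↭ₚ.drop-∷ (↭.↭-trans m↭xy (↭.swap x y ↭.refl))) = inj₂ refl

-- x_a x_b ↦ F a b, other monomials ↦ 0; the length clauses come first so that evalPair
-- reduces on every list whose length is not 2, whatever its entries.
evalPair : (ℕ → ℕ → Poly) → Mono → Poly
evalPair F []                   = []
evalPair F (_ ∷ [])             = []
evalPair F (_ ∷ _ ∷ _ ∷ _)      = []
evalPair F (var a ∷ var b ∷ []) = F a b
evalPair F (_ ∷ _ ∷ [])         = []

module _ (F : ℕ → ℕ → Poly) (F-comm : ∀ a b → F a b ≈P F b a) where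

  evalPair-swap : ∀ x y → evalPair F (x ∷ y ∷ []) ≈P evalPair F (y ∷ x ∷ [])
  evalPair-swap (var a) (var b) = F-comm a b
  evalPair-swap (var a) lam     = ≈P-refl
  evalPair-swap lam     (var b) = ≈P-refl
  evalPair-swap lam     lam     = ≈P-refl

  private
    evalPair-↭-nonPair : ∀ {m m′} → m ↭ m′ → length m ≢ 2 → [] ≈P evalPair F m′
    evalPair-↭-nonPair {m′ = m′} m↭m′ ∣m∣≢2 = ≈P-reflexive (sym (nonPair m′ (∣m∣≢2 ∘ trans (↭ₚ.↭-length m↭m′))))
      where
      nonPair : ∀ m′ → length m′ ≢ 2 → evalPair F m′ ≡ []
      nonPair []              _      = refl
      nonPair (_ ∷ [])        _      = refl
      nonPair (_ ∷ _ ∷ _ ∷ _) _      = refl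
      nonPair (_ ∷ _ ∷ [])    ∣m′∣≢2 = ⊥-elim (∣m′∣≢2 refl)

  evalPair-resp-↭ : ∀ {m m′} → m ↭ m′ → evalPair F m ≈P evalPair F m′
  evalPair-resp-↭ {x ∷ y ∷ []} m↭m′ with ↭-pair-inv (↭.↭-sym m↭m′)
  ... | inj₁ refl = ≈P-refl
  ... | inj₂ refl = evalPair-swap x y
  evalPair-resp-↭ {[]}            m↭m′ = evalPair-↭-nonPair m↭m′ λ ()
  evalPair-resp-↭ {_ ∷ []}        m↭m′ = evalPair-↭-nonPair m↭m′ λ ()
  evalPair-resp-↭ {_ ∷ _ ∷ _ ∷ _} m↭m′ = evalPair-↭-nonPair m↭m′ λ ()

square : ∀ {n} → Graph n → PMat n
square G = toP G · toP G

pairSum : ∀ {n} → (ℕ → ℕ → Poly) → Graph n → PMat n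
pairSum {n} F G i j = ΣFin n (λ l → F (G i l) (G l j))

evalPair-square : ∀ {n} (F : ℕ → ℕ → Poly) (G : Graph n) i j →
                  concatMap (evalPair F) (square G i j) ≈P pairSum F G i j
evalPair-square {n} F G i j = ≈P-trans
  (≈P-reflexive (concatMap-concatMap (evalPair F) (λ l → toP G i l *P toP G l j) (allFin n)))
  (ΣFin-cong n (λ l → ≈Pₚ.++-identityʳ _))

-- (G²)ᵢⱼ is the multiset of the commuting monomials x_{Gᵢₗ} x_{Gₗⱼ}, so every symmetric
-- function of the pairs (Gᵢₗ, Gₗⱼ) is determined by it.
pairSum-resp-square : ∀ {n} (F : ℕ → ℕ → Poly) → (∀ a b → F a b ≈P F b a) →
                      (G : Graph n) → ∀ {i j s t} → square G i j ≈P square G s t →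
                      pairSum F G i j ≈P pairSum F G s t
pairSum-resp-square F F-comm G {i} {j} {s} {t} sq≈sq = begin
  pairSum F G i j                          ↭⟨ evalPair-square F G i j ⟨
  concatMap (evalPair F) (square G i j)    ↭⟨ concatMap-resp-≈P (evalPair F) (evalPair-resp-↭ F F-comm) sq≈sq ⟩
  concatMap (evalPair F) (square G s t)    ↭⟨ evalPair-square F G s t ⟩
  pairSum F G s t                          ∎
  where open ≈P.PermutationReasoning

indicator : ∀ {A : Set} → Dec A → Poly
indicator (yes _) = 1P
indicator (no _)  = []

module _ {n} {P : Fin n → Set} (P? : ∀ l → Dec (P l)) where

  indicatorSum-nonempty : ∃ P → 0 < length (ΣFin n (indicator ∘ P?))
  indicatorSum-nonempty (l , p) = nonempty (∈ₚ.∈-concatMap⁺ (indicator ∘ P?) (lose (∈ₚ.∈-allFin l) ([]∈ (P? l))))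
    where
    []∈ : (d : Dec (P l)) → [] ∈ indicator d
    []∈ (yes _) = here refl
    []∈ (no ¬p) = ⊥-elim (¬p p)
    nonempty : ∀ {A : Set} {x : A} {xs} → x ∈ xs → 0 < length xs
    nonempty (here _)  = s≤s z≤n
    nonempty (there _) = s≤s z≤n

  indicatorSum-witness : 0 < length (ΣFin n (indicator ∘ P?)) → ∃ P
  indicatorSum-witness 0<len with ΣFin n (indicator ∘ P?) in eq
  ... | m ∷ _ with l , m∈ ← Any.satisfied (∈ₚ.∈-concatMap⁻ (indicator ∘ P?) {xs = allFin n} (subst (m ∈_) (sym eq) (here refl)))
    = l , holds (P? l) m∈
    where
    holds : (d : Dec (P l)) → m ∈ indicator d → P l
    holds (yes p) _ = p

module _ {R : ℕ → ℕ → Set} (R? : ∀ a b → Dec (R a b)) (R-sym : ∀ {a b} → R a b → R b a) where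

  indicator-comm : ∀ a b → indicator (R? a b) ≈P indicator (R? b a)
  indicator-comm a b with R? a b | R? b a
  ... | yes _   | yes _   = ≈P-refl
  ... | no  _   | no  _   = ≈P-refl
  ... | yes rab | no ¬rba = ⊥-elim (¬rba (R-sym rab))
  ... | no ¬rab | yes rba = ⊥-elim (¬rab (R-sym rba))

  pairWitness-resp-square : ∀ {n} (G : Graph n) {i j s t} → square G i j ≈P square G s t →
                            (∃ λ l → R (G i l) (G l j)) → ∃ λ l → R (G s l) (G l t)
  pairWitness-resp-square G {i} {j} {s} {t} sq≈sq witness =
    indicatorSum-witness (λ l → R? (G s l) (G l t))
      (subst (0 <_) (≈Pₚ.xs↭ys⇒|xs|≡|ys| indicatorSums≈)
        (indicatorSum-nonempty (λ l → R? (G i l) (G l j)) witness))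
    where
    indicatorSums≈ : pairSum (λ a b → indicator (R? a b)) G i j ≈P pairSum (λ a b → indicator (R? a b)) G s t
    indicatorSums≈ = pairSum-resp-square (λ a b → indicator (R? a b)) indicator-comm G sq≈sq

module _ {a ℓ} (S : Setoid a ℓ) where
  open Setoid S using (Carrier)
  private
    module Perm = SetoidPerm S
    module Permₚ = SetoidPermₚ S
  open import Data.List.Membership.Setoid S using () renaming (_∈_ to _∈ₛ_)
  import Data.List.Membership.Setoid.Properties as ∈ₛₚ

  ∈ₛ⇒↭∷ : ∀ {x : Carrier} {ys} → x ∈ₛ ys → ∃ λ ys′ → ys Perm.↭ x ∷ ys′
  ∈ₛ⇒↭∷ x∈ys with ys₁ , ys₂ , y , x≈y , ys≋ ← ∈ₛₚ.∈-∃++ S x∈ys =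
    ys₁ ++ ys₂ , Perm.↭-trans (Perm.↭-reflexive-≋ ys≋) (Permₚ.shift (Setoid.sym S x≈y) ys₁ ys₂)

  ∈-++-self⁻ : ∀ {x : Carrier} ys → x ∈ₛ ys ++ ys → x ∈ₛ ys
  ∈-++-self⁻ ys x∈ with ∈ₛₚ.∈-++⁻ S ys x∈
  ... | inj₁ x∈ys = x∈ys
  ... | inj₂ x∈ys = x∈ys

  ++-double-cancel : ∀ xs ys → xs ++ xs Perm.↭ ys ++ ys → xs Perm.↭ ys
  ++-double-cancel []       []       _     = Perm.↭-refl
  ++-double-cancel []       (y ∷ ys) []↭yy with () ← Permₚ.xs↭ys⇒|xs|≡|ys| []↭yy
  ++-double-cancel (x ∷ xs) ys       xx↭yy
    with ys′ , ys↭ ← ∈ₛ⇒↭∷ (∈-++-self⁻ ys (Permₚ.∈-resp-↭ xx↭yy (here (Setoid.refl S))))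
    = Perm.↭-trans (Perm.↭-prep x (++-double-cancel xs ys′ (Permₚ.drop-∷ (Permₚ.drop-∷ xxxs↭xxys′)))) (Perm.↭-sym ys↭)
    where
    doubled : ∀ zs → (x ∷ zs) ++ (x ∷ zs) Perm.↭ x ∷ x ∷ zs ++ zs
    doubled zs = Perm.↭-prep x (Permₚ.↭-shift zs zs)
    xxxs↭xxys′ : x ∷ x ∷ xs ++ xs Perm.↭ x ∷ x ∷ ys′ ++ ys′
    xxxs↭xxys′ = Perm.↭-trans (Perm.↭-sym (doubled xs))
                  (Perm.↭-trans xx↭yy (Perm.↭-trans (Permₚ.++⁺ ys↭ ys↭) (doubled ys′)))

-- Polynomial matrices determined by a graph

infix 4 _↣ᴾ_

_↣ᴾ_ : ∀ {n} → PMat n → Graph n → Set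
_↣ᴾ_ {n} M T = ∀ (i j s t : Fin n) → T i j ≡ T s t → M i j ≈P M s t

SquareClosed : ∀ {n} → Graph n → Set
SquareClosed T = square T ↣ᴾ T

module _ {n} {V : Set} (T : Graph n) (X : Fin n → Fin n → V) (default : V) where

  private
    Occurs : ℕ → Set
    Occurs c = ∃ λ s → ∃ λ t → T s t ≡ c

    pick : ∀ {c} → Dec (Occurs c) → V
    pick (yes (s , t , _)) = X s t
    pick (no _)            = default

    pick-spec : ∀ {c} (d : Dec (Occurs c)) → Occurs c →
                ∃ λ s → ∃ λ t → T s t ≡ c × pick d ≡ X s t
    pick-spec (yes (s , t , Tst≡c)) _ = s , t , Tst≡c , refl
    pick-spec (no ¬occurs)          occurs = ⊥-elim (¬occurs occurs)

  labelFunction : ℕ → V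
  labelFunction c = pick (Finₚ.any? λ s → Finₚ.any? λ t → T s t ℕ.≟ c)

  labelFunction-factorises : (_∼_ : V → V → Set) → (∀ i j s t → T i j ≡ T s t → X i j ∼ X s t) →
                             ∀ i j → X i j ∼ labelFunction (T i j)
  labelFunction-factorises _∼_ resp i j
    with s , t , Tst≡Tij , pick≡Xst ← pick-spec (Finₚ.any? λ s → Finₚ.any? λ t → T s t ℕ.≟ T i j) (i , j , refl)
    = subst (X i j ∼_) (sym pick≡Xst) (resp i j s t (sym Tst≡Tij))

↣ᴾ-resp-≈M : ∀ {n} {T : Graph n} {M M′ : PMat n} → M ≈M M′ → M ↣ᴾ T → M′ ↣ᴾ T
↣ᴾ-resp-≈M M≈M′ M↣T i j s t Tij≡Tst = ≈P-trans (≈P-sym (M≈M′ i j)) (≈P-trans (M↣T i j s t Tij≡Tst) (M≈M′ s t))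

module _ {n} {T : Graph n} (closed : SquareClosed T) where

  -- Writing M = g ∘ T and N = h ∘ T entrywise, (MN + NM)ᵢⱼ is a symmetric pair sum along T.
  jordan-↣ᴾ : ∀ {M N : PMat n} → M ↣ᴾ T → N ↣ᴾ T → (λ i j → (M · N) i j ++ (N · M) i j) ↣ᴾ T
  jordan-↣ᴾ {M} {N} M↣T N↣T i j s t Tij≡Tst = begin
    (M · N) i j ++ (N · M) i j  ↭⟨ asPairSum i j ⟩
    pairSum F T i j             ↭⟨ pairSum-resp-square F F-comm T (closed i j s t Tij≡Tst) ⟩
    pairSum F T s t             ↭⟨ asPairSum s t ⟨
    (M · N) s t ++ (N · M) s t  ∎
    where
    open ≈P.PermutationReasoning
    g h : ℕ → Poly
    g = labelFunction T M []
    h = labelFunction T N []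
    F : ℕ → ℕ → Poly
    F a b = (g a *P h b) ++ (h a *P g b)
    F-comm : ∀ a b → F a b ≈P F b a
    F-comm a b = ≈P-trans (≈Pₚ.++⁺ (*P-comm (g a) (h b)) (*P-comm (h a) (g b))) (≈Pₚ.++-comm (h b *P g a) (g b *P h a))
    asPairSum : ∀ i j → ((M · N) i j ++ (N · M) i j) ≈P pairSum F T i j
    asPairSum i j = ≈P-trans
      (≈P-sym (concatMap-++-distrib (λ l → M i l *P N l j) (λ l → N i l *P M l j) (allFin n)))
      (ΣFin-cong n (λ l → ≈Pₚ.++⁺ (*P-cong (M≈g i l) (N≈h l j)) (*P-cong (N≈h i l) (M≈g l j))))
      where
      M≈g : ∀ i j → M i j ≈P g (T i j)
      M≈g = labelFunction-factorises T M [] _≈P_ M↣T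
      N≈h : ∀ i j → N i j ≈P h (T i j)
      N≈h = labelFunction-factorises T N [] _≈P_ N↣T

  commuting-·-↣ᴾ : ∀ {M N : PMat n} → M ↣ᴾ T → N ↣ᴾ T → N · M ≈M M · N → M · N ↣ᴾ T
  commuting-·-↣ᴾ {M} {N} M↣T N↣T NM≈MN i j s t Tij≡Tst =
    ++-double-cancel monoSetoid ((M · N) i j) ((M · N) s t)
      (↣ᴾ-resp-≈M (λ i j → ≈Pₚ.++⁺ˡ ((M · N) i j) (NM≈MN i j)) (jordan-↣ᴾ M↣T N↣T) i j s t Tij≡Tst)

↣⇒toP-↣ᴾ : ∀ {n} {G T : Graph n} → G ↣ T → toP G ↣ᴾ T
↣⇒toP-↣ᴾ G↣T i j s t Tij≡Tst = ≈P-reflexive (cong (λ a → (var a ∷ []) ∷ []) (G↣T i j s t Tij≡Tst))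

idP-↣ᴾ : ∀ {n} {T : Graph n} → RecognizesVertices T → idP ↣ᴾ T
idP-↣ᴾ rv i j s t Tij≡Tst with i Fin.≟ j | s Fin.≟ t
... | yes refl | yes refl = ≈P-reflexive (trans (idP-diag i) (sym (idP-diag s)))
... | yes refl | no  s≢t = ⊥-elim (rv i s t s≢t Tij≡Tst)
... | no  i≢j  | yes refl = ⊥-elim (rv s i j i≢j (sym Tij≡Tst))
... | no  i≢j  | no  s≢t = ≈P-reflexive (trans (idP-offDiag i≢j) (sym (idP-offDiag s≢t)))

module _ {n} {T : Graph n} (rv : RecognizesVertices T) (closed : SquareClosed T) {G : Graph n} (G↣T : G ↣ T) where

  ^P-↣ᴾ : ∀ k → toP G ^P k ↣ᴾ T
  ^P-↣ᴾ zero    = idP-↣ᴾ rv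
  ^P-↣ᴾ (suc k) = commuting-·-↣ᴾ closed (↣⇒toP-↣ᴾ G↣T) (^P-↣ᴾ k) (^P-suc-comm (toP G) k)

  Γ-↣ᴾ : Γ G ↣ᴾ T
  Γ-↣ᴾ i j s t Tij≡Tst = concatMap-cong-≈P (upTo n) (λ k → *P-congʳ (lamPow k) (^P-↣ᴾ k i j s t Tij≡Tst))

square-↣ᴾ : ∀ {n} {G T : Graph n} → SquareClosed T → G ↣ T → square G ↣ᴾ T
square-↣ᴾ {G = G} closed G↣T = commuting-·-↣ᴾ closed (↣⇒toP-↣ᴾ G↣T) (↣⇒toP-↣ᴾ G↣T) (≈M-refl {M = square G})

module _ {n} {M : PMat n} {G T : Graph n} (evs : EVS M G) where

  EVS-↣ᴾ⇒↣ : M ↣ᴾ T → G ↣ T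
  EVS-↣ᴾ⇒↣ M↣T i j s t Tij≡Tst = Equivalence.from (proj₂ evs i j s t) (M↣T i j s t Tij≡Tst)

  EVS-↣⇒↣ᴾ : G ↣ T → M ↣ᴾ T
  EVS-↣⇒↣ᴾ G↣T i j s t Tij≡Tst = Equivalence.to (proj₂ evs i j s t) (G↣T i j s t Tij≡Tst)

↣-refl : ∀ {n} {A : Graph n} → A ↣ A
↣-refl i j s t Aij≡Ast = Aij≡Ast

↣-trans : ∀ {n} {A B C : Graph n} → A ↣ B → B ↣ C → A ↣ C
↣-trans A↣B B↣C i j s t Cij≡Cst = A↣B i j s t (B↣C i j s t Cij≡Cst)

RecognizesVertices-resp-↣ : ∀ {n} {A B : Graph n} → A ↣ B → RecognizesVertices A → RecognizesVertices B
RecognizesVertices-resp-↣ A↣B rvA i s t s≢t Bii≡Bst = rvA i s t s≢t (A↣B i i s t Bii≡Bst)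

OnDiagonal : ∀ {n} → Graph n → ℕ → Set
OnDiagonal {n} G a = ∃ λ (m : Fin n) → G m m ≡ a

onDiagonal-inv : ∀ {n} {G : Graph n} → RecognizesVertices G → ∀ {l t} → OnDiagonal G (G l t) → l ≡ t
onDiagonal-inv rv {l} {t} (m , Gmm≡Glt) with l Fin.≟ t
... | yes l≡t = l≡t
... | no  l≢t = ⊥-elim (rv m l t l≢t Gmm≡Glt)

module _ {n} (G : Graph n) (c : ℕ) where

  BesideDiagonal : ℕ → ℕ → Set
  BesideDiagonal a b = (a ≡ c × OnDiagonal G b) ⊎ (b ≡ c × OnDiagonal G a)

  besideDiagonal? : ∀ a b → Dec (BesideDiagonal a b)
  besideDiagonal? a b = (a ℕ.≟ c ×-dec onDiagonal? b) ⊎-dec (b ℕ.≟ c ×-dec onDiagonal? a)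
    where
    onDiagonal? : ∀ a → Dec (OnDiagonal G a)
    onDiagonal? a = Finₚ.any? λ m → G m m ℕ.≟ a

-- The term l = i of (G²)ᵢⱼ pairs Gᵢⱼ with a diagonal label; since G recognizes vertices,
-- a term of that kind in (G²)ₛₜ can only be the one pairing Gₛₜ with a diagonal label.
entries-from-square : ∀ {n} {G : Graph n} → RecognizesVertices G →
                      ∀ {i j s t} → square G i j ≈P square G s t → G i j ≡ G s t
entries-from-square {G = G} rv {i} {j} sq≈sq
  with pairWitness-resp-square (besideDiagonal? G (G i j)) swap G sq≈sq (i , inj₂ (refl , i , refl))
... | l , inj₁ (Gsl≡Gij , onDiag) with refl ← onDiagonal-inv rv onDiag = sym Gsl≡Gij
... | l , inj₂ (Glt≡Gij , onDiag) with refl ← onDiagonal-inv rv onDiag = sym Glt≡Gij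

-- Counting distinct entries

∈⇒↭∷ : ∀ {A : Set} {x : A} {ys} → x ∈ ys → ∃ λ ys′ → ys ↭ x ∷ ys′
∈⇒↭∷ x∈ys with ys₁ , ys₂ , refl ← ∈ₚ.∈-∃++ x∈ys = ys₁ ++ ys₂ , ↭ₚ.shift _ ys₁ ys₂

unique⊆⇒length≤ : ∀ {A : Set} {xs ys : List A} → Unique xs → xs ⊆ ys → length xs ≤ length ys
unique⊆⇒length≤ {xs = []}     _               _     = z≤n
unique⊆⇒length≤ {xs = x ∷ xs} {ys} (x∉xs ∷ unique) xs⊆ys with ys′ , ys↭ ← ∈⇒↭∷ (xs⊆ys (here refl)) =
  subst (suc (length xs) ≤_) (sym (↭ₚ.↭-length ys↭)) (s≤s (unique⊆⇒length≤ unique xs⊆ys′))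
  where
  xs⊆ys′ : xs ⊆ ys′
  xs⊆ys′ y∈xs with ↭ₚ.∈-resp-↭ ys↭ (xs⊆ys (there y∈xs))
  ... | here refl  = ⊥-elim (All.lookup x∉xs y∈xs refl)
  ... | there y∈ys′ = y∈ys′

unique⊆map⇒length< : ∀ {A B : Set} {xs : List B} {ys : List A} (g : A → B) → Unique xs →
                     xs ⊆ map g ys →
                     ∀ {v₁ v₂} → v₁ ∈ ys → v₂ ∈ ys → v₁ ≢ v₂ → g v₁ ≡ g v₂ → length xs < length ys
unique⊆map⇒length< {xs = xs} g unique xs⊆gys {v₁} v₁∈ys v₂∈ys v₁≢v₂ gv₁≡gv₂
  with ys′ , ys↭ ← ∈⇒↭∷ v₂∈ys =
  subst (suc (length xs) ≤_) (sym (↭ₚ.↭-length ys↭))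
    (s≤s (subst (length xs ≤_) (Listₚ.length-map g ys′) (unique⊆⇒length≤ unique xs⊆gys′)))
  where
  v₁∈ys′ : v₁ ∈ ys′
  v₁∈ys′ with ↭ₚ.∈-resp-↭ ys↭ v₁∈ys
  ... | here v₁≡v₂  = ⊥-elim (v₁≢v₂ v₁≡v₂)
  ... | there v₁∈ys′ = v₁∈ys′
  xs⊆gys′ : xs ⊆ map g ys′
  xs⊆gys′ x∈xs with v , v∈ys , refl ← ∈ₚ.∈-map⁻ g (xs⊆gys x∈xs) with ↭ₚ.∈-resp-↭ ys↭ v∈ys
  ... | here refl  = subst (_∈ map g ys′) gv₁≡gv₂ (∈ₚ.∈-map⁺ g v₁∈ys′)
  ... | there v∈ys′ = ∈ₚ.∈-map⁺ g v∈ys′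

∈-entries : ∀ {n} (G : Graph n) i j → G i j ∈ entries G
∈-entries {n} G i j = ∈ₚ.∈-concatMap⁺ (λ i → map (G i) (allFin n))
  (lose (∈ₚ.∈-allFin i) (∈ₚ.∈-map⁺ (G i) (∈ₚ.∈-allFin j)))

entries-∈ : ∀ {n} (G : Graph n) {a} → a ∈ entries G → ∃ λ i → ∃ λ j → G i j ≡ a
entries-∈ {n} G a∈ with i , a∈row ← Any.satisfied (∈ₚ.∈-concatMap⁻ (λ i → map (G i) (allFin n)) {xs = allFin n} a∈)
                   with j , _ , refl ← ∈ₚ.∈-map⁻ (G i) a∈row = i , j , refl

length-entries : ∀ {n} (G : Graph n) → length (entries G) ≡ n * n
length-entries {n} G = trans (rows (allFin n)) (cong (_* n) (Listₚ.length-tabulate {n = n} (λ i → i)))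
  where
  rows : (is : List (Fin n)) → length (concatMap (λ i → map (G i) (allFin n)) is) ≡ length is * n
  rows []       = refl
  rows (i ∷ is) = trans (Listₚ.length-++ (map (G i) (allFin n)))
    (cong₂ _+_ (trans (Listₚ.length-map (G i) (allFin n)) (Listₚ.length-tabulate (λ j → j))) (rows is))

distinctEntries : ∀ {n} → Graph n → List ℕ
distinctEntries G = deduplicate ℕ._≟_ (entries G)

∈-distinctEntries : ∀ {n} (G : Graph n) i j → G i j ∈ distinctEntries G
∈-distinctEntries G i j = ∈ₚ.∈-deduplicate⁺ ℕ._≟_ (∈-entries G i j)

distinctEntries-∈ : ∀ {n} (G : Graph n) {a} → a ∈ distinctEntries G → ∃ λ i → ∃ λ j → G i j ≡ a
distinctEntries-∈ G a∈ = entries-∈ G (∈ₚ.∈-deduplicate⁻ ℕ._≟_ (entries G) a∈)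

dim≤n² : ∀ {n} (G : Graph n) → dim G ≤ n * n
dim≤n² G = subst (dim G ≤_) (length-entries G) (Listₚ.length-deduplicate ℕ._≟_ (entries G))

module _ {n} {A B : Graph n} (A↣B : A ↣ B) where

  private
    g : ℕ → ℕ
    g = labelFunction B A 0

    g∘B≡A : ∀ i j → g (B i j) ≡ A i j
    g∘B≡A i j = sym (labelFunction-factorises B A 0 _≡_ A↣B i j)

    distinctA⊆gB : distinctEntries A ⊆ map g (distinctEntries B)
    distinctA⊆gB a∈ with i , j , refl ← distinctEntries-∈ A a∈ =
      subst (_∈ map g (distinctEntries B)) (g∘B≡A i j) (∈ₚ.∈-map⁺ g (∈-distinctEntries B i j))

  dim-mono : dim A ≤ dim B
  dim-mono = subst (dim A ≤_) (Listₚ.length-map g (distinctEntries B))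
    (unique⊆⇒length≤ (DecUniqueₚ.deduplicate-! ℕ._≟_ (entries A)) distinctA⊆gB)

  dim-≡⇒↣ : dim A ≡ dim B → B ↣ A
  dim-≡⇒↣ dimA≡dimB i j s t Aij≡Ast with B i j ℕ.≟ B s t
  ... | yes Bij≡Bst = Bij≡Bst
  ... | no  Bij≢Bst = ⊥-elim (ℕₚ.<-irrefl dimA≡dimB
    (unique⊆map⇒length< g (DecUniqueₚ.deduplicate-! ℕ._≟_ (entries A)) distinctA⊆gB
      (∈-distinctEntries B i j) (∈-distinctEntries B s t) Bij≢Bst
      (trans (g∘B≡A i j) (trans Aij≡Ast (sym (g∘B≡A s t))))))

-- Coefficients of λ in descriptions

isLam? : (x : Ind) → Dec (x ≡ lam)
isLam? lam     = yes refl
isLam? (var _) = no λ ()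

lamDegree : Mono → ℕ
lamDegree m = length (filter isLam? m)

dropLams : Mono → Mono
dropLams = filter (¬? ∘ isLam?)

lamCoeffMono : ℕ → Mono → Poly
lamCoeffMono k m = if does (lamDegree m ℕ.≟ k) then dropLams m ∷ [] else []

lamCoeff : ℕ → Poly → Poly
lamCoeff k = concatMap (lamCoeffMono k)

lamCoeff-resp-≈P : ∀ k {p q} → p ≈P q → lamCoeff k p ≈P lamCoeff k q
lamCoeff-resp-≈P k = concatMap-resp-≈P (lamCoeffMono k) resp
  where
  resp : ∀ {m m′} → m ↭ m′ → lamCoeffMono k m ≈P lamCoeffMono k m′
  resp {m} {m′} m↭m′ rewrite ↭ₚ.↭-length (↭ₚ.filter-↭ isLam? m↭m′) with does (lamDegree m′ ℕ.≟ k)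
  ... | true  = ≈P.prep (↭ₚ.filter-↭ (¬? ∘ isLam?) m↭m′) ≈P-refl
  ... | false = ≈P-refl

LamFree : Poly → Set
LamFree = All (All (λ x → ¬ x ≡ lam))

lamFree-concatMap : ∀ {A : Set} {f : A → Poly} (xs : List A) → (∀ x → LamFree (f x)) → LamFree (concatMap f xs)
lamFree-concatMap xs lamFree-f = Allₚ.concat⁺ (Allₚ.map⁺ (All.universal lamFree-f xs))

lamFree-*P : ∀ {p q} → LamFree p → LamFree q → LamFree (p *P q)
lamFree-*P lamFree-p lamFree-q =
  Allₚ.concat⁺ (Allₚ.map⁺ (All.map (λ lamFree-m → Allₚ.map⁺ (All.map (Allₚ.++⁺ lamFree-m) lamFree-q)) lamFree-p))

lamFree-^P : ∀ {n} (G : Graph n) k i j → LamFree ((toP G ^P k) i j)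
lamFree-^P G zero i j with toℕ i ℕ.≟ toℕ j
... | yes _ = [] ∷ []
... | no  _ = []
lamFree-^P {n} G (suc k) i j =
  lamFree-concatMap (allFin n) (λ l → lamFree-*P (((λ ()) ∷ []) ∷ []) (lamFree-^P G k l j))

lamCoeffMono-lamPow : ∀ k k′ {m} → All (λ x → ¬ x ≡ lam) m →
                      lamCoeffMono k (replicate k′ lam ++ m) ≡ (if does (k′ ℕ.≟ k) then m ∷ [] else [])
lamCoeffMono-lamPow k k′ {m} lamFree-m = cong₂ (λ d m → if does (d ℕ.≟ k) then m ∷ [] else []) degree dropped
  where
  lams : All (λ x → x ≡ lam) (replicate k′ lam)
  lams = Allₚ.replicate⁺ k′ refl
  degree : lamDegree (replicate k′ lam ++ m) ≡ k′
  degree = begin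
    length (filter isLam? (replicate k′ lam ++ m))
      ≡⟨ cong length (Listₚ.filter-++ isLam? (replicate k′ lam) m) ⟩
    length (filter isLam? (replicate k′ lam) ++ filter isLam? m)
      ≡⟨ cong₂ (λ xs ys → length (xs ++ ys)) (Listₚ.filter-all isLam? lams) (Listₚ.filter-none isLam? lamFree-m) ⟩
    length (replicate k′ lam ++ [])
      ≡⟨ cong length (Listₚ.++-identityʳ (replicate k′ lam)) ⟩
    length (replicate k′ lam)
      ≡⟨ Listₚ.length-replicate k′ ⟩
    k′ ∎
    where open ≡-Reasoning
  dropped : dropLams (replicate k′ lam ++ m) ≡ m
  dropped = trans (Listₚ.filter-++ (¬? ∘ isLam?) (replicate k′ lam) m)
                  (cong₂ _++_ (Listₚ.filter-none (¬? ∘ isLam?) (All.map (λ x≡lam x≢lam → x≢lam x≡lam) lams))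
                              (Listₚ.filter-all (¬? ∘ isLam?) lamFree-m))

lamCoeff-lamPow : ∀ k k′ {q} → LamFree q → lamCoeff k (lamPow k′ *P q) ≡ (if does (k′ ℕ.≟ k) then q else [])
lamCoeff-lamPow k k′ {q} lamFree-q = begin
  lamCoeff k (lamPow k′ *P q)
    ≡⟨⟩
  lamCoeff k (map (replicate k′ lam ++_) q ++ [])
    ≡⟨ cong (lamCoeff k) (Listₚ.++-identityʳ (map (replicate k′ lam ++_) q)) ⟩
  lamCoeff k (map (replicate k′ lam ++_) q)
    ≡⟨ Listₚ.concatMap-map (lamCoeffMono k) (replicate k′ lam ++_) q ⟩
  concatMap (λ m → lamCoeffMono k (replicate k′ lam ++ m)) q
    ≡⟨ cong concat (Listₚ.map-cong-local (All.map (lamCoeffMono-lamPow k k′) lamFree-q)) ⟩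
  concatMap (λ m → if does (k′ ℕ.≟ k) then m ∷ [] else []) q
    ≡⟨ select (does (k′ ℕ.≟ k)) q ⟩
  (if does (k′ ℕ.≟ k) then q else []) ∎
  where
  open ≡-Reasoning
  select : ∀ b (q : Poly) → concatMap (λ m → if b then m ∷ [] else []) q ≡ (if b then q else [])
  select true  q       = Listₚ.concatMap-pure q
  select false []      = refl
  select false (_ ∷ q) = select false q

Γ-lamCoeff : ∀ {n} (G : Graph n) {k} → k < n → ∀ i j → lamCoeff k (Γ G i j) ≈P (toP G ^P k) i j
Γ-lamCoeff {n} G {k} k<n i j = begin
  lamCoeff k (Γ G i j)
    ≡⟨ concatMap-concatMap (lamCoeffMono k) term (upTo n) ⟩
  concatMap (lamCoeff k ∘ term) (upTo n)
    ↭⟨ concatMap-single (Uniqueₚ.upTo⁺ n) (∈ₚ.∈-upTo⁺ k<n) vanish ⟩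
  lamCoeff k (term k)
    ≡⟨ lamCoeff-lamPow k k (lamFree-^P G k i j) ⟩
  (if does (k ℕ.≟ k) then (toP G ^P k) i j else [])
    ≡⟨ cong (if_then (toP G ^P k) i j else []) (dec-true (k ℕ.≟ k) refl) ⟩
  (toP G ^P k) i j ∎
  where
  open ≈P.PermutationReasoning
  term : ℕ → Poly
  term k′ = lamPow k′ *P (toP G ^P k′) i j
  vanish : ∀ k′ → k′ ≢ k → lamCoeff k (term k′) ≈P []
  vanish k′ k′≢k = ≈P-reflexive (trans (lamCoeff-lamPow k k′ (lamFree-^P G k′ i j))
                                       (cong (if_then (toP G ^P k′) i j else []) (dec-false (k′ ℕ.≟ k) k′≢k)))

1P≉0P : ¬ (1P ≈P 0P)
1P≉0P 1P≈0P with () ← ≈Pₚ.xs↭ys⇒|xs|≡|ys| 1P≈0P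

var-injective : ∀ {a b} → ((var a ∷ []) ∷ []) ≈P ((var b ∷ []) ∷ []) → a ≡ b
var-injective xa≈xb with ≈Pₚ.∈-resp-↭ xa≈xb (here ↭.refl)
... | here x↭y with refl ← ↭ₚ.↭-singleton-inv x↭y = refl

↣ᴾ-trans-↣ : ∀ {n} {M : PMat n} {T T′ : Graph n} → M ↣ᴾ T → T ↣ T′ → M ↣ᴾ T′
↣ᴾ-trans-↣ M↣T T↣T′ i j s t T′ij≡T′st = M↣T i j s t (T↣T′ i j s t T′ij≡T′st)

xy↭yx : ∀ a b → var a ∷ var b ∷ [] ↭ var b ∷ var a ∷ []
xy↭yx a b = ↭.swap (var a) (var b) ↭.refl

-- For n = 2 the description only records I and G, not G², so closedness is checked directly.
order2-squareClosed : (G : Graph 2) → RecognizesVertices G → SquareClosed G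
order2-squareClosed G rv 0F 0F 0F 0F e = ≈P-refl
order2-squareClosed G rv 0F 0F 0F 1F e = ⊥-elim (rv 0F 0F 1F (λ ()) e)
order2-squareClosed G rv 0F 0F 1F 0F e = ⊥-elim (rv 0F 1F 0F (λ ()) e)
order2-squareClosed G rv 0F 0F 1F 1F e rewrite e = ≈P.swap ↭.refl (xy↭yx _ _) ≈P-refl
order2-squareClosed G rv 0F 1F 0F 0F e = ⊥-elim (rv 0F 0F 1F (λ ()) (sym e))
order2-squareClosed G rv 0F 1F 0F 1F e = ≈P-refl
order2-squareClosed G rv 0F 1F 1F 0F e rewrite e = ≈P.prep (xy↭yx _ _) (≈P.prep (xy↭yx _ _) ≈P-refl)
order2-squareClosed G rv 0F 1F 1F 1F e = ⊥-elim (rv 1F 0F 1F (λ ()) (sym e))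
order2-squareClosed G rv 1F 0F 0F 0F e = ⊥-elim (rv 0F 1F 0F (λ ()) (sym e))
order2-squareClosed G rv 1F 0F 0F 1F e rewrite e = ≈P.prep (xy↭yx _ _) (≈P.prep (xy↭yx _ _) ≈P-refl)
order2-squareClosed G rv 1F 0F 1F 0F e = ≈P-refl
order2-squareClosed G rv 1F 0F 1F 1F e = ⊥-elim (rv 1F 1F 0F (λ ()) (sym e))
order2-squareClosed G rv 1F 1F 0F 0F e rewrite e = ≈P.swap (xy↭yx _ _) ↭.refl ≈P-refl
order2-squareClosed G rv 1F 1F 0F 1F e = ⊥-elim (rv 1F 0F 1F (λ ()) e)
order2-squareClosed G rv 1F 1F 1F 0F e = ⊥-elim (rv 1F 1F 0F (λ ()) e)
order2-squareClosed G rv 1F 1F 1F 1F e = ≈P-refl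

module _ {n} {G G′ : Graph n} (evs : EVS (Γ G) G′) where

  descriptionStep-^P-↣ᴾ : ∀ {k} → k < n → toP G ^P k ↣ᴾ G′
  descriptionStep-^P-↣ᴾ {k} k<n i j s t G′ij≡G′st = begin
    (toP G ^P k) i j        ↭⟨ Γ-lamCoeff G k<n i j ⟨
    lamCoeff k (Γ G i j)    ↭⟨ lamCoeff-resp-≈P k (EVS-↣⇒↣ᴾ evs ↣-refl i j s t G′ij≡G′st) ⟩
    lamCoeff k (Γ G s t)    ↭⟨ Γ-lamCoeff G k<n s t ⟩
    (toP G ^P k) s t        ∎
    where open ≈P.PermutationReasoning

  descriptionStep-recognizesVertices : RecognizesVertices G′
  descriptionStep-recognizesVertices i s t s≢t G′ii≡G′st = 1P≉0P (begin
    1P       ≡⟨ idP-diag i ⟨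
    idP i i  ↭⟨ descriptionStep-^P-↣ᴾ (ℕₚ.≤-trans (s≤s z≤n) (Finₚ.toℕ<n i)) i i s t G′ii≡G′st ⟩
    idP s t  ≡⟨ idP-offDiag s≢t ⟩
    0P       ∎)
    where open ≈P.PermutationReasoning

descriptionStep-↣ : ∀ {n} {G G′ : Graph n} → EVS (Γ G) G′ → G ↣ G′
descriptionStep-↣ {1}           evs 0F 0F 0F 0F _ = refl
descriptionStep-↣ {suc (suc n)} {G} evs i j s t G′ij≡G′st =
  var-injective (↣ᴾ-resp-≈M (·-identityʳ (toP G)) (descriptionStep-^P-↣ᴾ evs (s≤s (s≤s z≤n))) i j s t G′ij≡G′st)

descriptionStep-squareClosed : ∀ {n} {G G′ : Graph n} → EVS (Γ G) G′ → G′ ↣ G → RecognizesVertices G → SquareClosed G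
descriptionStep-squareClosed {1}                 evs G′↣G rv 0F 0F 0F 0F _ = ≈P-refl
descriptionStep-squareClosed {2}     {G}         evs G′↣G rv = order2-squareClosed G rv
descriptionStep-squareClosed {suc (suc (suc n))} {G} evs G′↣G rv = ↣ᴾ-trans-↣
  (↣ᴾ-resp-≈M (·-cong (≈M-refl {M = toP G}) (·-identityʳ (toP G))) (descriptionStep-^P-↣ᴾ evs (s≤s (s≤s (s≤s z≤n)))))
  G′↣G

-- The two sequences

module _ {n} {A A₁ : Graph n} where

  firstStep-recognizesVertices : FirstStep A A₁ → RecognizesVertices A₁
  firstStep-recognizesVertices (offDiag , _ , fresh , _) i s t s≢t A₁ii≡A₁st =
    fresh i s t s≢t (trans A₁ii≡A₁st (offDiag s t s≢t))

  firstStep-↣ : FirstStep A A₁ → A ↣ A₁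
  firstStep-↣ (offDiag , _ , fresh , diag⇔) i j s t A₁ij≡A₁st with i Fin.≟ j | s Fin.≟ t
  ... | yes refl | yes refl = Equivalence.to (diag⇔ i s) A₁ij≡A₁st
  ... | yes refl | no  s≢t = ⊥-elim (fresh i s t s≢t (trans A₁ij≡A₁st (offDiag s t s≢t)))
  ... | no  i≢j  | yes refl = ⊥-elim (fresh s i j i≢j (trans (sym A₁ij≡A₁st) (offDiag i j i≢j)))
  ... | no  i≢j  | no  s≢t = trans (sym (offDiag i j i≢j)) (trans A₁ij≡A₁st (offDiag s t s≢t))

  firstStep-↣-invariant : FirstStep A A₁ → ∀ {T} → RecognizesVertices T → A ↣ T → A₁ ↣ T
  firstStep-↣-invariant (offDiag , _ , _ , diag⇔) rv A↣T i j s t Tij≡Tst with i Fin.≟ j | s Fin.≟ t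
  ... | yes refl | yes refl = Equivalence.from (diag⇔ i s) (A↣T i i s s Tij≡Tst)
  ... | yes refl | no  s≢t = ⊥-elim (rv i s t s≢t Tij≡Tst)
  ... | no  i≢j  | yes refl = ⊥-elim (rv s i j i≢j (sym Tij≡Tst))
  ... | no  i≢j  | no  s≢t = trans (offDiag i j i≢j) (trans (A↣T i j s t Tij≡Tst) (sym (offDiag s t s≢t)))

squareStep-↣ : ∀ {n} {G G′ : Graph n} → EVS (square G) G′ → RecognizesVertices G → G ↣ G′
squareStep-↣ evs rv i j s t G′ij≡G′st = entries-from-square rv (EVS-↣⇒↣ᴾ evs ↣-refl i j s t G′ij≡G′st)

module _ {n} {A : Graph n} {S : ℕ → Graph n} (sas : IsSaS A S) where

  SaS-recognizesVertices : ∀ k → RecognizesVertices (S k)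
  SaS-recognizesVertices zero    = firstStep-recognizesVertices (proj₁ sas)
  SaS-recognizesVertices (suc k) =
    RecognizesVertices-resp-↣ (squareStep-↣ (proj₂ sas k) (SaS-recognizesVertices k)) (SaS-recognizesVertices k)

  SaS-↣-suc : ∀ k → S k ↣ S (suc k)
  SaS-↣-suc k = squareStep-↣ (proj₂ sas k) (SaS-recognizesVertices k)

  SaS-from-A : ∀ k → A ↣ S k
  SaS-from-A zero    = firstStep-↣ (proj₁ sas)
  SaS-from-A (suc k) = ↣-trans (SaS-from-A k) (SaS-↣-suc k)

  SaS-squareClosed : ∀ {t} → dim (S t) ≡ dim (S (suc t)) → SquareClosed (S t)
  SaS-squareClosed {t} plateau = EVS-↣⇒↣ᴾ (proj₂ sas t) (dim-≡⇒↣ (SaS-↣-suc t) plateau)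

  SaS-↣-invariant : ∀ {T} → RecognizesVertices T → SquareClosed T → A ↣ T → ∀ k → S k ↣ T
  SaS-↣-invariant rv closed A↣T zero    = firstStep-↣-invariant (proj₁ sas) rv A↣T
  SaS-↣-invariant rv closed A↣T (suc k) =
    EVS-↣ᴾ⇒↣ (proj₂ sas k) (square-↣ᴾ closed (SaS-↣-invariant rv closed A↣T k))

module _ {n} {A : Graph n} {B : ℕ → Graph n} (desc : IsDescSeq A B) where

  descSeq-↣-suc : ∀ k → B k ↣ B (suc k)
  descSeq-↣-suc k = descriptionStep-↣ (proj₂ desc k)

  descSeq-from-A : ∀ k → A ↣ B k
  descSeq-from-A zero    i j s t B0ij≡B0st = trans (sym (proj₁ desc i j)) (trans B0ij≡B0st (proj₁ desc s t))
  descSeq-from-A (suc k) = ↣-trans (descSeq-from-A k) (descSeq-↣-suc k)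

  descSeq-plateau-recognizesVertices : ∀ {t} → dim (B t) ≡ dim (B (suc t)) → RecognizesVertices (B t)
  descSeq-plateau-recognizesVertices {t} plateau =
    RecognizesVertices-resp-↣ (dim-≡⇒↣ (descSeq-↣-suc t) plateau) (descriptionStep-recognizesVertices (proj₂ desc t))

  descSeq-plateau-squareClosed : ∀ {t} → dim (B t) ≡ dim (B (suc t)) → SquareClosed (B t)
  descSeq-plateau-squareClosed {t} plateau = descriptionStep-squareClosed (proj₂ desc t)
    (dim-≡⇒↣ (descSeq-↣-suc t) plateau) (descSeq-plateau-recognizesVertices plateau)

  descSeq-↣-invariant : ∀ {T} → RecognizesVertices T → SquareClosed T → A ↣ T → ∀ k → B k ↣ T
  descSeq-↣-invariant rv closed A↣T zero    i j s t Tij≡Tst =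
    trans (proj₁ desc i j) (trans (A↣T i j s t Tij≡Tst) (sym (proj₁ desc s t)))
  descSeq-↣-invariant rv closed A↣T (suc k) =
    EVS-↣ᴾ⇒↣ (proj₂ desc k) (Γ-↣ᴾ rv closed (descSeq-↣-invariant rv closed A↣T k))

firstPlateau : (f : ℕ → ℕ) (N : ℕ) → (∀ k → f k ≤ f (suc k)) → (∀ k → f k ≤ N) →
               ∃ λ t → f t ≡ f (suc t) × (∀ k → k < t → f k ≢ f (suc k))
firstPlateau f N mono bounded = search (suc N) 0 z≤n (λ _ ()) (ℕₚ.n<1+n N)
  where
  -- below the first plateau f increases strictly, so k ≤ f k ≤ N bounds the search
  search : ∀ fuel k → k ≤ f k → (∀ m → m < k → f m ≢ f (suc m)) → N < k + fuel →
           ∃ λ t → f t ≡ f (suc t) × (∀ m → m < t → f m ≢ f (suc m))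
  search zero k k≤fk _ N<k+0 = ⊥-elim (ℕₚ.n≮n N (ℕₚ.<-≤-trans N<k+0
    (ℕₚ.≤-trans (ℕₚ.≤-reflexive (ℕₚ.+-identityʳ k)) (ℕₚ.≤-trans k≤fk (bounded k)))))
  search (suc fuel) k k≤fk increasing N<k+fuel with f k ℕ.≟ f (suc k)
  ... | yes plateau = k , plateau , increasing
  ... | no  ¬plateau = search fuel (suc k)
    (ℕₚ.≤-trans (s≤s k≤fk) (ℕₚ.≤∧≢⇒< (mono k) ¬plateau))
    increasing′
    (subst (N <_) (ℕₚ.+-suc k fuel) N<k+fuel)
    where
    increasing′ : ∀ m → m < suc k → f m ≢ f (suc m)
    increasing′ m m<1+k with m ℕ.≟ k
    ... | yes refl = ¬plateau
    ... | no  m≢k  = increasing m (ℕₚ.≤∧≢⇒< (ℕ.s≤s⁻¹ m<1+k) m≢k)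

descSeq-firstPlateau : ∀ {n} {A : Graph n} {B : ℕ → Graph n} → IsDescSeq A B → ∃ λ t → FirstStable B t
descSeq-firstPlateau {n} {B = B} desc =
  firstPlateau (dim ∘ B) (n * n) (λ k → dim-mono (descSeq-↣-suc desc k)) (λ k → dim≤n² (B k))

theorem3 : ∀ (n : ℕ) (A : Graph n) → Symmetric A →
    ∀ (S : ℕ → Graph n) → IsSaS A S →
      (∀ k → RecognizesVertices (S k)) ×
      (∀ k → (S k ↣ S (suc k)) × (dim (S k) ≤ dim (S (suc k)))) ×
      (∀ t → dim (S t) ≡ dim (S (suc t)) →
        ∀ (B : ℕ → Graph n) → IsDescSeq A B →
          ∃ λ t′ → FirstStable B t′ × (S t ≈G B t′))
theorem3 n A _ S sas =
  SaS-recognizesVertices sas ,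
  (λ k → SaS-↣-suc sas k , dim-mono (SaS-↣-suc sas k)) ,
  λ t plateauS B desc → stabilise t plateauS B desc (descSeq-firstPlateau desc)
  where
  stabilise : ∀ t → dim (S t) ≡ dim (S (suc t)) → ∀ B → IsDescSeq A B → ∃ (FirstStable B) →
              ∃ λ t′ → FirstStable B t′ × (S t ≈G B t′)
  stabilise t plateauS B desc (t′ , plateauB , first) =
    t′ , (plateauB , first) ,
    SaS-↣-invariant sas (descSeq-plateau-recognizesVertices desc plateauB)
      (descSeq-plateau-squareClosed desc plateauB) (descSeq-from-A desc t′) t ,
    descSeq-↣-invariant desc (SaS-recognizesVertices sas t) (SaS-squareClosed sas plateauS) (SaS-from-A sas t) t′
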